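{- The complete multipartite graph $K_{n_1,\ldots,n_m}$ has a distinguishing partition if and only if there exists an asymmetric hypergraph with $m$ edges of sizes $n_1,\ldots,n_m$.
   Context: $K_{n_1,\ldots,n_m}$ is the complete multipartite graph with parts of sizes $n_1,\dots,n_m$, with automorphism group $\mathrm{aut}(X)$. For a partition $P=\{P_1,\dots,P_t\}$ of the vertex set and $\gamma\in\mathrm{aut}(X)$, $\gamma(P)=\{\gamma(P_1),\dots,\gamma(P_t)\}$; $P$ is distinguishing if $\gamma(P)\ne P$ for all nontrivial $\gamma$. A hypergraph is a triple $(V,E,I)$ with finite sets $V,E$ and incidence relation $I\subseteq V\times E$ (multiple edges with the same vertex set are allowed); the size of an edge is the number of vertices incident to it. An automorphism is a pair of permutations of $V$ and $E$ preserving incidence in both directions; the hypergraph is asymmetric if its only automorphism is the trivial one. -}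

module Defs where

open import Data.Nat using (ℕ)
open import Data.Fin using (Fin)
open import Data.Fin.Subset using (Subset; ∣_∣)
open import Data.Vec using (tabulate)
open import Data.Bool using (Bool; true)
open import Data.Product using (Σ; _×_; ∃; _,_; proj₁)
open import Relation.Binary.PropositionalEquality using (_≡_; _≢_)
open import Relation.Nullary using (¬_)
open import Function.Bundles using (_↔_; _⇔_; Inverse)

KVertex : (m : ℕ) → (Fin m → ℕ) → Set
KVertex m ns = Σ (Fin m) (λ i → Fin (ns i))

KAdj : (m : ℕ) (ns : Fin m → ℕ) → KVertex m ns → KVertex m ns → Set
KAdj m ns (i , _) (j , _) = i ≢ j

IsKAut : (m : ℕ) (ns : Fin m → ℕ) → (KVertex m ns ↔ KVertex m ns) → Set
IsKAut m ns γ = ∀ x y → KAdj m ns x y ⇔ KAdj m ns (Inverse.to γ x) (Inverse.to γ y)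

IsTrivial : {A : Set} → (A ↔ A) → Set
IsTrivial {A} γ = ∀ (x : A) → Inverse.to γ x ≡ x

-- Partitions of a set V, encoded by a block-labelling c : V → ℕ;
-- the blocks of the partition are the nonempty fibres of c.

Partition : Set → Set
Partition V = V → ℕ

-- Two labellings describe the same partition (same set of blocks)
-- iff they induce the same "same block" relation.
SamePartition : {V : Set} → Partition V → Partition V → Set
SamePartition {V} c d = ∀ (x y : V) → (c x ≡ c y) ⇔ (d x ≡ d y)

-- γ(P) = {γ(P_1),...,γ(P_t)}: the block of x in γ(P) is γ applied to the
-- block of γ⁻¹ x in P, so γ(P) is labelled by c ∘ γ⁻¹.
imagePartition : {V : Set} → (V ↔ V) → Partition V → Partition V
imagePartition γ c x = c (Inverse.from γ x)

IsDistinguishing : (m : ℕ) (ns : Fin m → ℕ) → Partition (KVertex m ns) → Set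
IsDistinguishing m ns P =
  ∀ (γ : KVertex m ns ↔ KVertex m ns) → IsKAut m ns γ →
    ¬ IsTrivial γ → ¬ SamePartition (imagePartition γ P) P

HasDistinguishingPartition : (m : ℕ) → (Fin m → ℕ) → Set
HasDistinguishingPartition m ns =
  Σ (Partition (KVertex m ns)) (IsDistinguishing m ns)

-- Hypergraphs (V, E, I) with V = Fin p, E = Fin q and incidence relation
-- I ⊆ V × E given by its (decidable) characteristic function.
-- Multiple edges with the same vertex set are allowed.

Incidence : ℕ → ℕ → Set
Incidence p q = Fin p → Fin q → Bool

edgeSize : {p q : ℕ} → Incidence p q → Fin q → ℕ
edgeSize {p} I e = ∣ tabulate (λ (v : Fin p) → I v e) ∣

IsHAut : {p q : ℕ} → Incidence p q → (Fin p ↔ Fin p) → (Fin q ↔ Fin q) → Set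
IsHAut I σ τ = ∀ v e → (I v e ≡ true) ⇔ (I (Inverse.to σ v) (Inverse.to τ e) ≡ true)

IsAsymmetric : {p q : ℕ} → Incidence p q → Set
IsAsymmetric {p} {q} I =
  ∀ (σ : Fin p ↔ Fin p) (τ : Fin q ↔ Fin q) → IsHAut I σ τ →
    IsTrivial σ × IsTrivial τ

HasAsymmetricHypergraph : (m : ℕ) → (Fin m → ℕ) → Set
HasAsymmetricHypergraph m ns =
  Σ ℕ λ p → Σ (Incidence p m) λ I →
    IsAsymmetric I × (∀ i → edgeSize I i ≡ ns i)

-- Both sides are two views of one combinatorial object, a *realisation*: a
-- hypergraph I together with a labelling of the vertices of K by hypergraph
-- vertices which maps part i bijectively onto edge i.  Then the vertices of K
-- are exactly the incident (vertex, edge) pairs of I, and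
--   * hypergraph automorphisms (σ , τ) lift to automorphisms of K that
--     preserve the labelling (τ permutes the parts, σ the labels), and
--   * automorphisms of K preserving the labelling descend to hypergraph
--     automorphisms,
-- compatibly in both directions, so one side is trivial iff the other is.
-- Given an asymmetric hypergraph, enumerating every edge yields a realisation
-- whose labelling is a distinguishing partition.  Conversely, a
-- distinguishing partition is injective on every part (otherwise a
-- transposition inside a part fixes it); numbering its blocks 0,...,p-1
-- turns it into a realisation of the hypergraph "block b lies on edge i iff b
-- meets part i", which is asymmetric.

module Submission where

open import Defs
open import Data.Nat using (ℕ; zero; suc; _≤_; _<_; s≤s; _⊔_)
open import Data.Nat.Properties using (m≤m⊔n; m≤n⊔m; ≤-trans)
open import Data.Fin using (Fin; zero; suc; toℕ; fromℕ<; _≟_)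
open import Data.Fin.Properties
  using (any?; toℕ-injective; fromℕ<-cong; fromℕ<-injective; suc-injective; cantor-schröder-bernstein)
open import Data.Fin.Subset using (∣_∣)
open import Data.Vec using (tabulate)
open import Data.Bool using (Bool; true; false)
open import Data.Product using (Σ; _×_; ∃; _,_; proj₁; proj₂)
open import Data.Product.Properties using (≡-dec)
open import Function using (_∘_)
open import Function.Bundles using (_↔_; _⇔_; Inverse; Equivalence; mk↔ₛ′; mk⇔)
open import Function.Definitions using (Injective)
open import Function.Properties.Equivalence using () renaming (sym to ⇔-sym; trans to ⇔-trans)
open import Function.Properties.Inverse using (↔-sym)
open import Relation.Binary.Definitions using (DecidableEquality)
open import Relation.Binary.PropositionalEquality
open import Relation.Nullary using (¬_; Dec; yes; no; does; contradiction)
open import Relation.Nullary.Decidable using (map′; dec-true; decidable-stable)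

open Inverse using (to; from; strictlyInverseˡ; strictlyInverseʳ)

does-true : {A : Set} (a? : Dec A) → does a? ≡ true → A
does-true (yes a) _ = a

-- Between decidable propositions, equivalence of the negations is
-- equivalence; this is how adjacency in K turns into "same part".
¬⇔¬⇒⇔ : {A B : Set} → Dec A → Dec B → ((¬ A) ⇔ (¬ B)) → A ⇔ B
¬⇔¬⇒⇔ a? b? neg = mk⇔
  (λ a → decidable-stable b? (λ ¬b → Equivalence.from neg ¬b a))
  (λ b → decidable-stable a? (λ ¬a → Equivalence.to neg ¬a b))

⇔⇒¬⇔¬ : {A B : Set} → A ⇔ B → (¬ A) ⇔ (¬ B)
⇔⇒¬⇔¬ eq = mk⇔ (λ ¬a b → ¬a (Equivalence.from eq b)) (λ ¬b a → ¬b (Equivalence.to eq a))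

↔-injective : {A : Set} (γ : A ↔ A) → Injective _≡_ _≡_ (to γ)
↔-injective γ {x} {y} e =
  trans (sym (strictlyInverseʳ γ x)) (trans (cong (from γ) e) (strictlyInverseʳ γ y))

Searchable : Set → Set₁
Searchable V = {P : V → Set} → (∀ x → Dec (P x)) → Dec (∃ P)

-- Automorphisms of K are the bijections respecting the kernel of "part",
-- and a bijection fixes a partition iff it respects its labelling's kernel.
Respects : {V A : Set} → (V → A) → (V → V) → Set
Respects f g = ∀ x y → f x ≡ f y ⇔ f (g x) ≡ f (g y)

respects-commuting : {V A : Set} {f : V → A} {g : V → V} {h : A → A} →
  Injective _≡_ _≡_ h → (∀ x → f (g x) ≡ h (f x)) → Respects f g
respects-commuting {f = f} {h = h} h-inj comm x y = mk⇔
  (λ e → trans (comm x) (trans (cong h e) (sym (comm y))))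
  (λ e → h-inj (trans (sym (comm x)) (trans e (comm y))))

respects-kernel : {V A B : Set} {f : V → A} {f′ : V → B} {g : V → V} →
  (∀ x y → f x ≡ f y ⇔ f′ x ≡ f′ y) → Respects f g → Respects f′ g
respects-kernel {g = g} same resp x y = mk⇔
  (λ e → Equivalence.to (same (g x) (g y))
           (Equivalence.to (resp x y) (Equivalence.from (same x y) e)))
  (λ e → Equivalence.to (same x y)
           (Equivalence.from (resp x y) (Equivalence.from (same (g x) (g y)) e)))

respects-inverse : {V A : Set} {f : V → A} (γ : V ↔ V) → Respects f (to γ) → Respects f (from γ)
respects-inverse {f = f} γ resp x y = mk⇔
  (λ e → Equivalence.from (resp (from γ x) (from γ y))
           (subst₂ (λ a b → f a ≡ f b) (sym (strictlyInverseˡ γ x)) (sym (strictlyInverseˡ γ y)) e))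
  (λ e → subst₂ (λ a b → f a ≡ f b) (strictlyInverseˡ γ x) (strictlyInverseˡ γ y)
           (Equivalence.to (resp (from γ x) (from γ y)) e))

fixes-partition⇔respects : {V : Set} (γ : V ↔ V) (c : Partition V) →
  SamePartition (imagePartition γ c) c ⇔ Respects c (to γ)
fixes-partition⇔respects γ c = mk⇔
  (λ same → respects-inverse (↔-sym γ) (λ x y → ⇔-sym (same x y)))
  (λ resp x y → ⇔-sym (respects-inverse γ resp x y))

-- Transposition of two points of a type with decidable equality; it is the
-- nontrivial automorphism witnessing that a distinguishing partition
-- separates the vertices of each part.
module Transposition {A : Set} (_≟A_ : DecidableEquality A) (u v : A) where

  swap : A → A
  swap x with x ≟A u
  ... | yes _ = v
  ... | no _ with x ≟A v
  ...   | yes _ = u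
  ...   | no _ = x

  swap-u : swap u ≡ v
  swap-u with u ≟A u
  ... | yes _ = refl
  ... | no u≢u = contradiction refl u≢u

  swap-v : swap v ≡ u
  swap-v with v ≟A u
  ... | yes v≡u = v≡u
  ... | no _ with v ≟A v
  ...   | yes _ = refl
  ...   | no v≢v = contradiction refl v≢v

  swap-other : ∀ x → ¬ x ≡ u → ¬ x ≡ v → swap x ≡ x
  swap-other x x≢u x≢v with x ≟A u
  ... | yes x≡u = contradiction x≡u x≢u
  ... | no _ with x ≟A v
  ...   | yes x≡v = contradiction x≡v x≢v
  ...   | no _ = refl

  swap-invariant : {B : Set} (g : A → B) → g u ≡ g v → ∀ x → g (swap x) ≡ g x
  swap-invariant g guv x = by-cases (x ≟A u) (x ≟A v)
    where
    by-cases : Dec (x ≡ u) → Dec (x ≡ v) → g (swap x) ≡ g x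
    by-cases (yes refl) _ = trans (cong g swap-u) (sym guv)
    by-cases (no _) (yes refl) = trans (cong g swap-v) guv
    by-cases (no x≢u) (no x≢v) = cong g (swap-other x x≢u x≢v)

  swap-involutive : ∀ x → swap (swap x) ≡ x
  swap-involutive x = by-cases (x ≟A u) (x ≟A v)
    where
    by-cases : Dec (x ≡ u) → Dec (x ≡ v) → swap (swap x) ≡ x
    by-cases (yes refl) _ = trans (cong swap swap-u) swap-v
    by-cases (no _) (yes refl) = trans (cong swap swap-v) swap-u
    by-cases (no x≢u) (no x≢v) = trans (cong swap (swap-other x x≢u x≢v)) (swap-other x x≢u x≢v)

  transposition : A ↔ A
  transposition = mk↔ₛ′ swap swap swap-involutive swap-involutive

-- An enumeration of length k of {v | P v}: an injection Fin k → Fin p onto it.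
-- Enumerations are how edge sizes (cardinalities of Boolean vectors) are counted.
record Enumeration {p : ℕ} (P : Fin p → Bool) (k : ℕ) : Set where
  field
    elem           : Fin k → Fin p
    elem-true      : ∀ a → P (elem a) ≡ true
    elem-injective : Injective _≡_ _≡_ elem
    elem-onto      : ∀ v → P v ≡ true → ∃ λ a → elem a ≡ v

module _ {p k : ℕ} {P : Fin (suc p) → Bool} where

  enumeration-cons-true : P zero ≡ true → Enumeration (P ∘ suc) k → Enumeration P (suc k)
  enumeration-cons-true P0 E = record
    { elem = elem′ ; elem-true = true′ ; elem-injective = injective′ ; elem-onto = onto′ }
    where
    open Enumeration E
    elem′ : Fin (suc k) → Fin (suc p)
    elem′ zero = zero
    elem′ (suc a) = suc (elem a)
    true′ : ∀ a → P (elem′ a) ≡ true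
    true′ zero = P0
    true′ (suc a) = elem-true a
    injective′ : Injective _≡_ _≡_ elem′
    injective′ {zero} {zero} _ = refl
    injective′ {suc a} {suc b} e = cong suc (elem-injective (suc-injective e))
    onto′ : ∀ v → P v ≡ true → ∃ λ a → elem′ a ≡ v
    onto′ zero _ = zero , refl
    onto′ (suc v) Pv with elem-onto v Pv
    ... | a , refl = suc a , refl

  enumeration-cons-false : P zero ≡ false → Enumeration (P ∘ suc) k → Enumeration P k
  enumeration-cons-false P0 E = record
    { elem = suc ∘ elem ; elem-true = elem-true
    ; elem-injective = elem-injective ∘ suc-injective ; elem-onto = onto′ }
    where
    open Enumeration E
    onto′ : ∀ v → P v ≡ true → ∃ λ a → suc (elem a) ≡ v
    onto′ zero Pv = contradiction (trans (sym P0) Pv) λ ()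
    onto′ (suc v) Pv with elem-onto v Pv
    ... | a , refl = a , refl

enumerate : {p : ℕ} (P : Fin p → Bool) → Enumeration P ∣ tabulate P ∣
enumerate {zero} P = record
  { elem = λ () ; elem-true = λ () ; elem-injective = λ {} ; elem-onto = λ () }
enumerate {suc p} P with P zero in P0
... | true = enumeration-cons-true P0 (enumerate (P ∘ suc))
... | false = enumeration-cons-false P0 (enumerate (P ∘ suc))

module _ {p k l : ℕ} {P : Fin p → Bool} (E : Enumeration P k) (F : Enumeration P l) where
  private
    module E = Enumeration E
    module F = Enumeration F

    located : ∀ a → ∃ λ b → F.elem b ≡ E.elem a
    located a = F.elem-onto (E.elem a) (E.elem-true a)

  reindex : Fin k → Fin l
  reindex a = proj₁ (located a)

  reindex-injective : Injective _≡_ _≡_ reindex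
  reindex-injective {a} {b} e =
    E.elem-injective (trans (sym (proj₂ (located a))) (trans (cong F.elem e) (proj₂ (located b))))

enumeration-unique : {p k l : ℕ} {P : Fin p → Bool} → Enumeration P k → Enumeration P l → k ≡ l
enumeration-unique E F = cantor-schröder-bernstein (reindex-injective E F) (reindex-injective F E)

enumeration-size : {p k : ℕ} {P : Fin p → Bool} → Enumeration P k → ∣ tabulate P ∣ ≡ k
enumeration-size {P = P} E = enumeration-unique (enumerate P) E

enumeration-of-size : {p k : ℕ} (P : Fin p → Bool) → ∣ tabulate P ∣ ≡ k → Enumeration P k
enumeration-of-size P size = subst (Enumeration P) size (enumerate P)

-- The image of a map from a searchable type into Fin L, numbered 0,...,size-1:
-- f factors as a surjection `index` onto Fin size followed by an injection,
-- so `index` has the same kernel as f.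
module Image {V : Set} (search : Searchable V) {L : ℕ} (f : V → Fin L) where

  hit? : ∀ ℓ → Dec (∃ λ x → f x ≡ ℓ)
  hit? ℓ = search (λ x → f x ≟ ℓ)

  inImage : Fin L → Bool
  inImage ℓ = does (hit? ℓ)

  size : ℕ
  size = ∣ tabulate inImage ∣

  private module E = Enumeration (enumerate inImage)

  private
    located : ∀ x → ∃ λ a → E.elem a ≡ f x
    located x = E.elem-onto (f x) (dec-true (hit? (f x)) (x , refl))

  index : V → Fin size
  index x = proj₁ (located x)

  index-kernel : ∀ x y → index x ≡ index y ⇔ f x ≡ f y
  index-kernel x y = mk⇔
    (λ e → trans (sym (proj₂ (located x))) (trans (cong E.elem e) (proj₂ (located y))))
    (λ e → E.elem-injective (trans (proj₂ (located x)) (trans e (sym (proj₂ (located y))))))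

  index-surjective : ∀ a → ∃ λ x → index x ≡ a
  index-surjective a with does-true (hit? (E.elem a)) (E.elem-true a)
  ... | x , fx≡ = x , E.elem-injective (trans (proj₂ (located x)) fx≡)

maxOver : (n : ℕ) → (Fin n → ℕ) → ℕ
maxOver zero f = 0
maxOver (suc n) f = f zero ⊔ maxOver n (f ∘ suc)

≤-maxOver : (n : ℕ) (f : Fin n → ℕ) (i : Fin n) → f i ≤ maxOver n f
≤-maxOver (suc n) f zero = m≤m⊔n (f zero) _
≤-maxOver (suc n) f (suc i) = ≤-trans (≤-maxOver n (f ∘ suc) i) (m≤n⊔m (f zero) _)

PreservesIncidence : {p m : ℕ} → Incidence p m → (Fin p → Fin p) → (Fin m → Fin m) → Set
PreservesIncidence I σ τ = ∀ v e → I v e ≡ true → I (σ v) (τ e) ≡ true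

haut⇔preserves : {p m : ℕ} (I : Incidence p m) (σ : Fin p ↔ Fin p) (τ : Fin m ↔ Fin m) →
  IsHAut I σ τ ⇔ (PreservesIncidence I (to σ) (to τ) × PreservesIncidence I (from σ) (from τ))
haut⇔preserves I σ τ = mk⇔
  (λ aut → (λ v e → Equivalence.to (aut v e))
         , (λ v e h → Equivalence.from (aut (from σ v) (from τ e))
              (subst₂ incident (sym (strictlyInverseˡ σ v)) (sym (strictlyInverseˡ τ e)) h)))
  (λ (fwd , bwd) v e → mk⇔ (fwd v e)
         (λ h → subst₂ incident (strictlyInverseʳ σ v) (strictlyInverseʳ τ e) (bwd _ _ h)))
  where
  incident : Fin _ → Fin _ → Set
  incident v e = I v e ≡ true

module Multipartite (m : ℕ) (ns : Fin m → ℕ) where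

  V : Set
  V = KVertex m ns

  part : V → Fin m
  part = proj₁

  _≟V_ : DecidableEquality V
  _≟V_ = ≡-dec _≟_ _≟_

  searchVertex : Searchable V
  searchVertex P? = map′ (λ (i , a , h) → (i , a) , h) (λ ((i , a) , h) → i , a , h)
                         (any? λ i → any? λ a → P? (i , a))

  kaut⇔respects-parts : (γ : V ↔ V) → IsKAut m ns γ ⇔ Respects part (to γ)
  kaut⇔respects-parts γ = mk⇔
    (λ aut x y → ¬⇔¬⇒⇔ (part x ≟ part y) (part (to γ x) ≟ part (to γ y)) (aut x y))
    (λ resp x y → ⇔⇒¬⇔¬ (resp x y))

  -- A labelling by naturals takes finitely many values; as a labelling by
  -- Fin (suc (maxLabel c)) it has the same kernel.
  maxLabel : (V → ℕ) → ℕ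
  maxLabel c = maxOver m (λ i → maxOver (ns i) (λ a → c (i , a)))

  maxLabel-bound : (c : V → ℕ) → ∀ x → c x < suc (maxLabel c)
  maxLabel-bound c (i , a) = s≤s (≤-trans (≤-maxOver (ns i) (λ a → c (i , a)) a)
                                          (≤-maxOver m (λ i → maxOver (ns i) (λ a → c (i , a))) i))

  finLabel : (c : V → ℕ) → V → Fin (suc (maxLabel c))
  finLabel c x = fromℕ< (maxLabel-bound c x)

  finLabel-kernel : (c : V → ℕ) → ∀ x y → c x ≡ c y ⇔ finLabel c x ≡ finLabel c y
  finLabel-kernel c x y = mk⇔ (λ e → fromℕ<-cong _ _ e _ _)
                              (fromℕ<-injective _ _ (maxLabel-bound c x) (maxLabel-bound c y))

  -- A realisation of the hypergraph I by K: part i is labelled bijectively by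
  -- the vertices of edge i.  The vertices of K then are the flags (v , e) of I.
  record Realisation {p : ℕ} (I : Incidence p m) : Set where
    field
      lab           : V → Fin p
      lab-injective : ∀ i {a b} → lab (i , a) ≡ lab (i , b) → a ≡ b
      lab-incident  : ∀ x → I (lab x) (part x) ≡ true
      lab-onto      : ∀ v e → I v e ≡ true → ∃ λ a → lab (e , a) ≡ v

  -- In a realisation edge i has exactly ns i vertices: part i enumerates it.
  realisation-edge-size : {p : ℕ} {I : Incidence p m} →
    Realisation I → ∀ i → edgeSize I i ≡ ns i
  realisation-edge-size {I = I} R i = enumeration-size {P = λ v → I v i} record
    { elem = λ a → lab (i , a) ; elem-true = λ a → lab-incident (i , a)
    ; elem-injective = lab-injective i ; elem-onto = λ v → lab-onto v i }
    where open Realisation R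

  module Correspondence {p : ℕ} {I : Incidence p m}
                        (R : Realisation I) where
    open Realisation R

    vertex-determined : ∀ x y → part x ≡ part y → lab x ≡ lab y → x ≡ y
    vertex-determined (i , a) (.i , b) refl e = cong (i ,_) (lab-injective i e)

    record Corresponds (γ : V → V) (σ : Fin p → Fin p) (τ : Fin m → Fin m) : Set where
      field
        on-labels : ∀ x → lab (γ x) ≡ σ (lab x)
        on-parts  : ∀ x → part (γ x) ≡ τ (part x)

    -- An incidence preserving (σ , τ) lifts: (i , a) goes to the vertex of part
    -- τ i labelled σ (lab (i , a)), which exists since that label lies on τ i.
    module Lift (σ : Fin p → Fin p) (τ : Fin m → Fin m) (pres : PreservesIncidence I σ τ) where
      private
        target : ∀ x → ∃ λ a → lab (τ (part x) , a) ≡ σ (lab x)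
        target x = lab-onto (σ (lab x)) (τ (part x)) (pres _ _ (lab-incident x))

      γ : V → V
      γ x = τ (part x) , proj₁ (target x)

      corresponds : Corresponds γ σ τ
      corresponds = record { on-labels = proj₂ ∘ target ; on-parts = λ _ → refl }

    corresponds-inverse : ∀ {γ γ′ σ σ′ τ τ′} → Corresponds γ σ τ → Corresponds γ′ σ′ τ′ →
      (∀ v → σ′ (σ v) ≡ v) → (∀ i → τ′ (τ i) ≡ i) → ∀ x → γ′ (γ x) ≡ x
    corresponds-inverse {γ} {γ′} {σ} {σ′} {τ} {τ′} C C′ σσ′ ττ′ x = vertex-determined _ _
      (begin part (γ′ (γ x)) ≡⟨ on-parts C′ (γ x) ⟩ τ′ (part (γ x)) ≡⟨ cong τ′ (on-parts C x) ⟩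
             τ′ (τ (part x)) ≡⟨ ττ′ (part x) ⟩      part x ∎)
      (begin lab (γ′ (γ x))  ≡⟨ on-labels C′ (γ x) ⟩ σ′ (lab (γ x)) ≡⟨ cong σ′ (on-labels C x) ⟩
             σ′ (σ (lab x))  ≡⟨ σσ′ (lab x) ⟩        lab x ∎)
      where open Corresponds
            open ≡-Reasoning

    lift-aut : (σ : Fin p ↔ Fin p) (τ : Fin m ↔ Fin m) → IsHAut I σ τ →
      Σ (V ↔ V) λ γ → IsKAut m ns γ × Respects lab (to γ) × Corresponds (to γ) (to σ) (to τ)
    lift-aut σ τ aut =
        γ
      , Equivalence.from (kaut⇔respects-parts γ)
          (respects-commuting {f = part} {g = to γ} (↔-injective τ) (Corresponds.on-parts L.corresponds))
      , respects-commuting (↔-injective σ) (Corresponds.on-labels L.corresponds)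
      , L.corresponds
      where
      preserves : PreservesIncidence I (to σ) (to τ) × PreservesIncidence I (from σ) (from τ)
      preserves = Equivalence.to (haut⇔preserves I σ τ) aut
      module L  = Lift (to σ) (to τ) (proj₁ preserves)
      module L′ = Lift (from σ) (from τ) (proj₂ preserves)
      γ : V ↔ V
      γ = mk↔ₛ′ L.γ L′.γ
            (corresponds-inverse L′.corresponds L.corresponds (strictlyInverseˡ σ) (strictlyInverseˡ τ))
            (corresponds-inverse L.corresponds L′.corresponds (strictlyInverseʳ σ) (strictlyInverseʳ τ))

    -- A map of K preserving "same part" and "same label" descends: τ sends the
    -- part of x to that of g x (parts are nonempty), σ sends the label of x to
    -- that of g x and fixes the hypergraph vertices on no edge.
    module Descend (nonempty : ∀ i → 1 ≤ ns i) (g : V → V)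
                   (parts : Respects part g) (labels : Respects lab g) where

      τ : Fin m → Fin m
      τ i = part (g (i , fromℕ< (nonempty i)))

      σ : Fin p → Fin p
      σ v with searchVertex (λ x → lab x ≟ v)
      ... | yes (x , _) = lab (g x)
      ... | no _ = v

      σ-unlabelled : ∀ v → ¬ (∃ λ x → lab x ≡ v) → σ v ≡ v
      σ-unlabelled v none with searchVertex (λ x → lab x ≟ v)
      ... | yes found = contradiction found none
      ... | no _ = refl

      corresponds : Corresponds g σ τ
      corresponds = record { on-labels = on-labels ; on-parts = on-parts }
        where
        on-labels : ∀ x → lab (g x) ≡ σ (lab x)
        on-labels x with searchVertex (λ y → lab y ≟ lab x)
        ... | yes (y , e) = Equivalence.to (labels x y) (sym e)
        ... | no none = contradiction (x , refl) none
        on-parts : ∀ x → part (g x) ≡ τ (part x)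
        on-parts x = Equivalence.to (parts x (part x , fromℕ< (nonempty (part x)))) refl

      preserves : PreservesIncidence I σ τ
      preserves v e h with lab-onto v e h
      ... | a , refl = subst₂ (λ w f → I w f ≡ true)
                         (Corresponds.on-labels corresponds (e , a))
                         (Corresponds.on-parts corresponds (e , a))
                         (lab-incident (g (e , a)))

    module DescendInverse (nonempty : ∀ i → 1 ≤ ns i) (g g′ : V → V) (g′g : ∀ x → g′ (g x) ≡ x)
                          (parts : Respects part g) (labels : Respects lab g)
                          (parts′ : Respects part g′) (labels′ : Respects lab g′) where
      module D  = Descend nonempty g parts labels
      module D′ = Descend nonempty g′ parts′ labels′
      open Corresponds
      open ≡-Reasoning

      τ-inverse : ∀ i → D′.τ (D.τ i) ≡ i
      τ-inverse i = begin
        D′.τ (D.τ i)     ≡⟨ sym (on-parts D′.corresponds (g x)) ⟩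
        part (g′ (g x))  ≡⟨ cong part (g′g x) ⟩
        i                ∎
        where x = (i , fromℕ< (nonempty i))

      σ-inverse : ∀ v → D′.σ (D.σ v) ≡ v
      σ-inverse v = by-cases v (searchVertex (λ x → lab x ≟ v))
        where
        by-cases : ∀ v → Dec (∃ λ x → lab x ≡ v) → D′.σ (D.σ v) ≡ v
        by-cases .(lab x) (yes (x , refl)) = begin
          D′.σ (D.σ (lab x)) ≡⟨ cong D′.σ (sym (on-labels D.corresponds x)) ⟩
          D′.σ (lab (g x))   ≡⟨ sym (on-labels D′.corresponds (g x)) ⟩
          lab (g′ (g x))     ≡⟨ cong lab (g′g x) ⟩
          lab x              ∎
        by-cases v (no none) = trans (cong D′.σ (D.σ-unlabelled v none)) (D′.σ-unlabelled v none)

    descend-aut : (∀ i → 1 ≤ ns i) → (γ : V ↔ V) → IsKAut m ns γ → Respects lab (to γ) →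
      Σ (Fin p ↔ Fin p) λ σ → Σ (Fin m ↔ Fin m) λ τ →
        IsHAut I σ τ × Corresponds (to γ) (to σ) (to τ)
    descend-aut nonempty γ kaut resp = σ , τ , aut , D.corresponds
      where
      parts-resp : Respects part (to γ)
      parts-resp = Equivalence.to (kaut⇔respects-parts γ) kaut
      module DI  = DescendInverse nonempty (to γ) (from γ) (strictlyInverseʳ γ)
                     parts-resp resp
                     (respects-inverse γ parts-resp) (respects-inverse γ resp)
      module DI′ = DescendInverse nonempty (from γ) (to γ) (strictlyInverseˡ γ)
                     (respects-inverse γ parts-resp) (respects-inverse γ resp)
                     parts-resp resp
      module D  = DI.D
      module D′ = DI.D′
      σ : Fin p ↔ Fin p
      σ = mk↔ₛ′ D.σ D′.σ DI′.σ-inverse DI.σ-inverse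
      τ : Fin m ↔ Fin m
      τ = mk↔ₛ′ D.τ D′.τ DI′.τ-inverse DI.τ-inverse
      aut : IsHAut I σ τ
      aut = Equivalence.from (haut⇔preserves I σ τ) (D.preserves , D′.preserves)

    trivial-lifts : ∀ {γ σ τ} → Corresponds γ σ τ → (∀ v → σ v ≡ v) → (∀ i → τ i ≡ i) → ∀ x → γ x ≡ x
    trivial-lifts C σ-id τ-id = corresponds-inverse C identity σ-id τ-id
      where
      identity : Corresponds (λ x → x) (λ v → v) (λ i → i)
      identity = record { on-labels = λ _ → refl ; on-parts = λ _ → refl }

    trivial-descends : ∀ {γ σ τ} → Corresponds γ σ τ → (∀ x → γ x ≡ x) →
      (∀ x → σ (lab x) ≡ lab x) × (∀ x → τ (part x) ≡ part x)
    trivial-descends C γ-id =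
        (λ x → trans (sym (Corresponds.on-labels C x)) (cong lab (γ-id x)))
      , (λ x → trans (sym (Corresponds.on-parts C x)) (cong part (γ-id x)))

  realise-by-enumeration : {p : ℕ} (I : Incidence p m) →
    (∀ i → edgeSize I i ≡ ns i) → Realisation I
  realise-by-enumeration I sizes = record
    { lab = λ (i , a) → Enumeration.elem (E i) a
    ; lab-injective = λ i → Enumeration.elem-injective (E i)
    ; lab-incident = λ (i , a) → Enumeration.elem-true (E i) a
    ; lab-onto = λ v e → Enumeration.elem-onto (E e) v }
    where
    E : ∀ i → Enumeration (λ v → I v i) _
    E i = enumeration-of-size (λ v → I v i) (sizes i)

  -- The labelling of a realisation of an asymmetric hypergraph is distinguishing:
  -- an automorphism of K fixing it descends to a trivial automorphism.
  asymmetric⇒distinguishing : {p : ℕ} → (∀ i → 1 ≤ ns i) →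
    {I : Incidence p m} → IsAsymmetric I → (R : Realisation I) →
    IsDistinguishing m ns (toℕ ∘ Realisation.lab R)
  asymmetric⇒distinguishing nonempty asym R γ kaut nontrivial same =
    let (σ , τ , aut , C) = descend-aut nonempty γ kaut labels-respected
        (σ-trivial , τ-trivial) = asym σ τ aut
    in nontrivial (trivial-lifts C σ-trivial τ-trivial)
    where
    open Correspondence R
    labels-respected : Respects (Realisation.lab R) (to γ)
    labels-respected = respects-kernel (λ x y → ⇔-sym (mk⇔ (cong toℕ) toℕ-injective))
                         (Equivalence.to (fixes-partition⇔respects γ _) same)

  module FromPartition (nonempty : ∀ i → 1 ≤ ns i)
                       (c : Partition V) (dist : IsDistinguishing m ns c) where

    rigid : (γ : V ↔ V) → IsKAut m ns γ → Respects c (to γ) → ¬ ¬ IsTrivial γ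
    rigid γ kaut resp nontrivial =
      dist γ kaut nontrivial (Equivalence.from (fixes-partition⇔respects γ c) resp)

    -- P separates the vertices of each part: otherwise the transposition of two
    -- vertices of a part in the same block is a nontrivial automorphism fixing P.
    c-injective : ∀ i {a b} → c (i , a) ≡ c (i , b) → a ≡ b
    c-injective i {a} {b} same-block = decidable-stable (a ≟ b) λ a≢b →
      rigid transposition
        (Equivalence.from (kaut⇔respects-parts transposition)
          (respects-commuting {f = part} {g = swap} {h = λ i → i} (λ e → e) (swap-invariant part refl)))
        (respects-commuting {h = λ n → n} (λ e → e) (swap-invariant c same-block))
        (λ trivial → a≢b (toℕ-injective (cong position (trans (sym (trivial (i , a))) swap-u))))
      where
      open Transposition (_≟V_) (i , a) (i , b)
      position : V → ℕ
      position x = toℕ (proj₂ x)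

    open Image searchVertex (finLabel c) renaming (size to p; index to blk)

    blk-kernel : ∀ x y → blk x ≡ blk y ⇔ c x ≡ c y
    blk-kernel x y = ⇔-trans (index-kernel x y) (⇔-sym (finLabel-kernel c x y))

    I : Incidence p m
    I b i = does (any? λ a → blk (i , a) ≟ b)

    realisation : Realisation I
    realisation = record
      { lab = blk
      ; lab-injective = λ i e → c-injective i (Equivalence.to (blk-kernel _ _) e)
      ; lab-incident = λ (i , a) → dec-true (any? λ a′ → blk (i , a′) ≟ blk (i , a)) (a , refl)
      ; lab-onto = λ b i h → does-true (any? λ a → blk (i , a) ≟ b) h }

    open Correspondence realisation using (lift-aut; trivial-descends; Corresponds)

    -- A map (σ , τ) of the hypergraph of blocks corresponding to an
    -- automorphism γ of K fixing P is trivial: γ is trivial, so σ fixes every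
    -- block (each is the block of a vertex) and τ every part (parts are nonempty).
    forced-trivial : {σ : Fin p → Fin p} {τ : Fin m → Fin m} (γ : V ↔ V) →
      IsKAut m ns γ → Respects blk (to γ) → Corresponds (to γ) σ τ →
      (∀ b → σ b ≡ b) × (∀ i → τ i ≡ i)
    forced-trivial {σ} {τ} γ kaut resp C = fixes-blocks , fixes-parts
      where
      forced : {n : ℕ} {s t : Fin n} → Dec (s ≡ t) → (IsTrivial γ → s ≡ t) → s ≡ t
      forced s≟t from-trivial = decidable-stable s≟t λ s≢t →
        rigid γ kaut (respects-kernel blk-kernel resp) (s≢t ∘ from-trivial)

      fixes-blocks : ∀ b → σ b ≡ b
      fixes-blocks b with index-surjective b
      ... | x , refl = forced (σ (blk x) ≟ blk x) λ trivial → proj₁ (trivial-descends C trivial) x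

      fixes-parts : ∀ i → τ i ≡ i
      fixes-parts i = forced (τ i ≟ i) λ trivial →
        proj₂ (trivial-descends C trivial) (i , fromℕ< (nonempty i))

    -- The hypergraph of blocks is asymmetric: its automorphisms lift to
    -- automorphisms of K fixing P.
    asymmetric : IsAsymmetric I
    asymmetric σ τ aut =
      let (γ , kaut , resp , C) = lift-aut σ τ aut in forced-trivial γ kaut resp C

    hypergraph : HasAsymmetricHypergraph m ns
    hypergraph = p , I , asymmetric , realisation-edge-size realisation

corollary3p2 : (m : ℕ) (ns : Fin m → ℕ) → (∀ i → 1 ≤ ns i) →
    HasDistinguishingPartition m ns ⇔ HasAsymmetricHypergraph m ns
corollary3p2 m ns nonempty = mk⇔
  (λ (c , dist) → FromPartition.hypergraph nonempty c dist)
  (λ (p , I , asym , sizes) →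
     let R = realise-by-enumeration I sizes in
     toℕ ∘ Realisation.lab R , asymmetric⇒distinguishing nonempty asym R)
  where open Multipartite m ns
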